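{- Let $T$ be a tournament, $S\subseteq V(T)$ and $F\subseteq A(T)$. Then $F$ is an inclusion-wise minimal set of arcs such that $T-F$ has no $S$-cycle if and only if $F$ is an inclusion-wise minimal set of arcs such that $T\circledast F$ has no $S$-cycle.
   Context: A tournament is a directed graph with exactly one arc between every pair of distinct vertices. An $S$-cycle is a directed cycle containing at least one vertex of $S$. $T-F$ is the digraph obtained from $T$ by deleting the arcs of $F$. $T\circledast F$ is the digraph obtained from $T$ by reversing every arc of $F$, i.e. with vertex set $V(T)$ and arc set $(A(T)\setminus F)\cup\{(u,v): (v,u)\in F\}$. -}

module Defs where

open import Data.Nat using (ℕ)
open import Data.Bool using (Bool; true; false; _∧_; _∨_; not)
open import Data.Fin using (Fin)
open import Data.List using (List; []; _∷_; last)
open import Data.List.Relation.Unary.Unique.Propositional using (Unique)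
open import Data.List.Relation.Unary.Any using (Any)
open import Data.Maybe using (just)
open import Data.Product using (Σ; _×_; ∃-syntax)
open import Relation.Binary.PropositionalEquality using (_≡_; _≢_)
open import Relation.Nullary using (¬_)

Digraph : ℕ → Set
Digraph n = Fin n → Fin n → Bool

ArcSet : ℕ → Set
ArcSet = Digraph

VSet : ℕ → Set
VSet n = Fin n → Bool

record IsTournament {n : ℕ} (T : Digraph n) : Set where
  field
    irrefl : ∀ v → T v v ≡ false
    oneArc : ∀ u v → u ≢ v → T u v ≡ not (T v u)

_⊆A_ : ∀ {n} → ArcSet n → ArcSet n → Set
F ⊆A G = ∀ u v → F u v ≡ true → G u v ≡ true

_⊂A_ : ∀ {n} → ArcSet n → ArcSet n → Set
F ⊂A G = (F ⊆A G) × (∃[ u ] ∃[ v ] (G u v ≡ true × F u v ≡ false))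

_−A_ : ∀ {n} → Digraph n → ArcSet n → Digraph n
(T −A F) u v = T u v ∧ not (F u v)

_⊛_ : ∀ {n} → Digraph n → ArcSet n → Digraph n
(T ⊛ F) u v = (T u v ∧ not (F u v)) ∨ F v u

PathArcs : ∀ {n} → Digraph n → List (Fin n) → Set
PathArcs D [] = Data.Unit.⊤ where import Data.Unit
PathArcs D (x ∷ []) = Data.Unit.⊤ where import Data.Unit
PathArcs D (x ∷ y ∷ xs) = (D x y ≡ true) × PathArcs D (y ∷ xs)

record Cycle {n : ℕ} (D : Digraph n) : Set where
  field
    first : Fin n
    rest  : List (Fin n)
    distinct : Unique (first ∷ rest)
    arcs  : PathArcs D (first ∷ rest)
    lastV : Fin n
    isLast : last (first ∷ rest) ≡ just lastV
    closing : D lastV first ≡ true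

vertices : ∀ {n} {D : Digraph n} → Cycle D → List (Fin n)
vertices C = Cycle.first C ∷ Cycle.rest C

SCycle : ∀ {n} → VSet n → Digraph n → Set
SCycle S D = Σ (Cycle D) λ C → Any (λ v → S v ≡ true) (vertices C)

NoSCycle : ∀ {n} → VSet n → Digraph n → Set
NoSCycle S D = ¬ SCycle S D

Minimal : ∀ {n} → (ArcSet n → Set) → ArcSet n → Set
Minimal P F = P F × (∀ F' → F' ⊂A F → ¬ P F')

{-# OPTIONS --safe #-}
-- If F is minimal with T − F free of S-cycles, every arc qp of F is essential: putting it back
-- creates an S-cycle, which must run through qp, so T − F has a walk from p to q. Replacing each
-- reversed arc of T ⊛ F by such a walk turns an S-cycle of T ⊛ F into one of T − F. Conversely
-- T − F ⊆ T ⊛ F, and if some F′ ⊂ F already made T − F′ free of S-cycles, a minimal G ⊆ F′ with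
-- that property would make T ⊛ G free as well, contradicting the minimality of F for ⊛.
module Submission where

open import Defs
open import Data.Nat using (ℕ)
open import Data.Bool using (true; false; _∧_; not; if_then_else_)
open import Data.Bool.Properties using (not-¬; ¬-not)
open import Data.Fin using (Fin)
open import Data.Fin.Properties using (_≟_)
open import Data.List using (List; []; _∷_; last; allFin; cartesianProduct)
open import Data.List.Relation.Unary.All using ([])
open import Data.List.Relation.Unary.All.Properties.Core using (¬Any⇒All¬)
open import Data.List.Relation.Unary.AllPairs using ([]; _∷_)
open import Data.List.Relation.Unary.Any using (here; there; any?)
open import Data.List.Relation.Unary.Unique.Propositional using (Unique)
open import Data.List.Membership.Propositional using (_∈_; _∉_; find; lose)
open import Data.List.Membership.Propositional.Properties using (∈-allFin; ∈-cartesianProduct⁺)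
open import Data.Maybe using (just)
open import Data.Product using (_×_; _,_; proj₁; proj₂; ∃-syntax)
open import Data.Product.Properties using (≡-dec)
open import Data.Sum using (_⊎_; inj₁; inj₂)
open import Data.Unit using (tt)
open import Effect.Monad using (RawMonad)
open import Function using (case_of_)
open import Function.Bundles using (_⇔_; mk⇔)
open import Level using (0ℓ)
open import Relation.Binary.Core using (Rel)
open import Relation.Binary.Definitions using (DecidableEquality)
open import Relation.Binary.Construct.Closure.ReflexiveTransitive using (Star; ε; _◅_; _◅◅_)
open import Relation.Binary.Construct.Closure.Transitive using (TransClosure; [_]; _∷_; _++_)
open import Relation.Binary.PropositionalEquality using (_≡_; _≢_; refl)
open import Relation.Nullary using (¬_; Dec; yes; no; does; contradiction)
open import Relation.Nullary.Decidable using (¬¬-excluded-middle)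
open import Relation.Nullary.Negation using (¬¬-Monad)

-- Whether deleting an arc creates an S-cycle is never decided, but every conclusion drawn
-- from such a case split is negative, so the splits are made in the double-negation monad.
open RawMonad (¬¬-Monad {0ℓ}) using (pure; _>>=_)

private variable
  n : ℕ

module _ {a ℓ} {A : Set a} {R : Rel A ℓ} where

  ◅⋆⇒⁺ : ∀ {x y z} → R x y → Star R y z → TransClosure R x z
  ◅⋆⇒⁺ r ε       = [ r ]
  ◅⋆⇒⁺ r (s ◅ w) = r ∷ ◅⋆⇒⁺ s w

  ⋆⁺⇒⁺ : ∀ {x y z} → Star R x y → TransClosure R y z → TransClosure R x z
  ⋆⁺⇒⁺ ε       t = t
  ⋆⁺⇒⁺ (r ◅ w) t = r ∷ ⋆⁺⇒⁺ w t

  ⁺⇒⋆ : ∀ {x y} → TransClosure R x y → Star R x y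
  ⁺⇒⋆ [ r ]   = r ◅ ε
  ⁺⇒⋆ (r ∷ t) = r ◅ ⁺⇒⋆ t

  ⋆⇒⁺ : ∀ {x y} → x ≢ y → Star R x y → TransClosure R x y
  ⋆⇒⁺ x≢x ε       = contradiction refl x≢x
  ⋆⇒⁺ _   (r ◅ w) = ◅⋆⇒⁺ r w

  ⁺-uncons : ∀ {x y} → TransClosure R x y → ∃[ z ] R x z × Star R z y
  ⁺-uncons [ r ]   = _ , r , ε
  ⁺-uncons (r ∷ t) = _ , r , ⁺⇒⋆ t

module _ {a ℓ ℓ′} {A : Set a} {R : Rel A ℓ} {R′ : Rel A ℓ′} {q p : A}
         (R⊆R′+qp : ∀ {u v} → R u v → (u , v) ≡ (q , p) ⊎ R′ u v) where

  ⁺-avoids-or-crosses : ∀ {x y} → TransClosure R x y →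
                        TransClosure R′ x y ⊎ (Star R′ x q × Star R′ p y)
  ⁺-avoids-or-crosses [ r ] with R⊆R′+qp r
  ... | inj₁ refl = inj₂ (ε , ε)
  ... | inj₂ r′   = inj₁ [ r′ ]
  ⁺-avoids-or-crosses (r ∷ t) with R⊆R′+qp r | ⁺-avoids-or-crosses t
  ... | inj₁ refl | inj₁ t′         = inj₂ (ε , ⁺⇒⋆ t′)
  ... | inj₁ refl | inj₂ (_ , w)    = inj₂ (ε , w)
  ... | inj₂ r′   | inj₁ t′         = inj₁ (r′ ∷ t′)
  ... | inj₂ r′   | inj₂ (w₁ , w₂)  = inj₂ (r′ ◅ w₁ , w₂)

last-∈ : ∀ {a} {A : Set a} {y : A} xs → last xs ≡ just y → y ∈ xs
last-∈ (x ∷ [])     refl = here refl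
last-∈ (_ ∷ x ∷ xs) eq   = there (last-∈ (x ∷ xs) eq)

Arc : Digraph n → Rel (Fin n) 0ℓ
Arc D u v = D u v ≡ true

Walk Walk⁺ : Digraph n → Rel (Fin n) 0ℓ
Walk D  = Star (Arc D)
Walk⁺ D = TransClosure (Arc D)

SClosedWalk : VSet n → Digraph n → Set
SClosedWalk S D = ∃[ s ] S s ≡ true × Walk⁺ D s s

SimplePath : Digraph n → Fin n → Fin n → Set
SimplePath D x y = ∃[ r ] Unique (x ∷ r) × PathArcs D (x ∷ r) × last (x ∷ r) ≡ just y

module _ {D : Digraph n} where

  PathArcs⇒walks : ∀ f r {l x} → PathArcs D (f ∷ r) → last (f ∷ r) ≡ just l →
                   x ∈ f ∷ r → Walk D f x × Walk D x l
  PathArcs⇒walks f []      _        refl (here refl) = ε , ε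
  PathArcs⇒walks f (y ∷ r) (a , as) eq   (here refl) = ε , a ◅ proj₂ (PathArcs⇒walks y r as eq (here refl))
  PathArcs⇒walks f (y ∷ r) (a , as) eq   (there x∈)  =
    let w₁ , w₂ = PathArcs⇒walks y r as eq x∈ in a ◅ w₁ , w₂

  SimplePath-suffix : ∀ {f x y} (P : SimplePath D f y) → x ∈ f ∷ proj₁ P → SimplePath D x y
  SimplePath-suffix P                                (here refl) = P
  SimplePath-suffix (y ∷ r , _ ∷ u , (_ , as) , eq) (there x∈)  = SimplePath-suffix (r , u , as , eq) x∈

  Walk⇒SimplePath : ∀ {x y} → Walk D x y → SimplePath D x y
  Walk⇒SimplePath ε = [] , [] ∷ [] , tt , refl
  Walk⇒SimplePath {x} (_◅_ {j = y} a w) with Walk⇒SimplePath w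
  ... | P@(r , u , as , eq) with any? (x ≟_) (y ∷ r)
  ...   | yes x∈ = SimplePath-suffix P x∈
  ...   | no  x∉ = y ∷ r , ¬Any⇒All¬ _ x∉ ∷ u , (a , as) , eq

  module _ {S : VSet n} where

    SCycle⇒SClosedWalk : SCycle S D → SClosedWalk S D
    SCycle⇒SClosedWalk (C , S∩C) =
      let s , s∈C , Ss = find S∩C
          f⇝s , s⇝l    = PathArcs⇒walks first rest arcs isLast s∈C
      in s , Ss , ⋆⁺⇒⁺ s⇝l (◅⋆⇒⁺ closing f⇝s)
      where open Cycle C

    SClosedWalk⇒SCycle : SClosedWalk S D → SCycle S D
    SClosedWalk⇒SCycle (s , Ss , s⇝s) =
      let z , s→z , z⇝s  = ⁺-uncons s⇝s
          r , u , as , eq = Walk⇒SimplePath z⇝s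
      in record { first = z ; rest = r ; distinct = u ; arcs = as
                ; lastV = s ; isLast = eq ; closing = s→z }
       , lose (last-∈ (z ∷ r) eq) Ss

PathArcs-mono : ∀ {D D′ : Digraph n} → D ⊆A D′ → ∀ xs → PathArcs D xs → PathArcs D′ xs
PathArcs-mono D⊆D′ []           _        = tt
PathArcs-mono D⊆D′ (_ ∷ [])     _        = tt
PathArcs-mono D⊆D′ (x ∷ y ∷ xs) (a , as) = D⊆D′ x y a , PathArcs-mono D⊆D′ (y ∷ xs) as

SCycle-mono : ∀ {S : VSet n} {D D′ : Digraph n} → D ⊆A D′ → SCycle S D → SCycle S D′
SCycle-mono D⊆D′ (C , S∩C) =
  record { first = first ; rest = rest ; distinct = distinct ; arcs = PathArcs-mono D⊆D′ _ arcs
         ; lastV = lastV ; isLast = isLast ; closing = D⊆D′ _ _ closing } , S∩C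
  where open Cycle C

_≟ₐ_ : DecidableEquality (Fin n × Fin n)
_≟ₐ_ = ≡-dec _≟_ _≟_

remove : ArcSet n → Fin n → Fin n → ArcSet n
remove G q p u v = if does ((u , v) ≟ₐ (q , p)) then false else G u v

module _ {G : ArcSet n} {q p : Fin n} where

  remove-⊆ : remove G q p ⊆A G
  remove-⊆ u v h with (u , v) ≟ₐ (q , p)
  ... | yes _ = contradiction h λ ()
  ... | no  _ = h

  remove-removes : remove G q p q p ≡ false
  remove-removes with (q , p) ≟ₐ (q , p)
  ... | yes _   = refl
  ... | no  q≢q = contradiction refl q≢q

  remove-≢ : ∀ {u v} → Arc (remove G q p) u v → (u , v) ≢ (q , p)
  remove-≢ h refl = not-¬ h remove-removes

  remove-⊂ : G q p ≡ true → remove G q p ⊂A G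
  remove-⊂ g = remove-⊆ , q , p , g , remove-removes

  remove-mono : ∀ {F} → F ⊆A G → remove F q p ⊆A remove G q p
  remove-mono F⊆G u v h with (u , v) ≟ₐ (q , p)
  ... | yes _ = h
  ... | no  _ = F⊆G u v h

⊆-refl : {G : ArcSet n} → G ⊆A G
⊆-refl _ _ h = h

⊆-trans : {F G H : ArcSet n} → F ⊆A G → G ⊆A H → F ⊆A H
⊆-trans F⊆G G⊆H u v h = G⊆H u v (F⊆G u v h)

⊆-⊂-trans : {F G H : ArcSet n} → F ⊆A G → G ⊂A H → F ⊂A H
⊆-⊂-trans F⊆G (G⊆H , u , v , Huv , Guv) =
  ⊆-trans F⊆G G⊆H , u , v , Huv , ¬-not λ Fuv → not-¬ (F⊆G u v Fuv) Guv

⊂⇒⊆-remove : {F G : ArcSet n} → F ⊂A G → ∃[ u ] ∃[ v ] G u v ≡ true × F ⊆A remove G u v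
⊂⇒⊆-remove {F = F} {G} (F⊆G , u , v , Guv , Fuv) = u , v , Guv , F⊆G-uv
  where
  F⊆G-uv : F ⊆A remove G u v
  F⊆G-uv a b h with (a , b) ≟ₐ (u , v)
  ... | yes refl = contradiction h (not-¬ Fuv)
  ... | no  _    = F⊆G a b h

allArcs : ∀ n → List (Fin n × Fin n)
allArcs n = cartesianProduct (allFin n) (allFin n)

∈-allArcs : ∀ (q p : Fin n) → (q , p) ∈ allArcs n
∈-allArcs q p = ∈-cartesianProduct⁺ (∈-allFin q) (∈-allFin p)

UpwardClosed : (ArcSet n → Set) → Set
UpwardClosed {n} P = ∀ {F G : ArcSet n} → F ⊆A G → P F → P G

LocallyMinimal : (ArcSet n → Set) → ArcSet n → Set
LocallyMinimal P G = P G × (∀ q p → G q p ≡ true → ¬ P (remove G q p))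

module _ {P : ArcSet n → Set} (up : UpwardClosed P) where

  locallyMinimal⇒minimal : ∀ {G} → LocallyMinimal P G → Minimal P G
  locallyMinimal⇒minimal (PG , essential) = PG , λ F F⊂G PF →
    let u , v , Guv , F⊆G-uv = ⊂⇒⊆-remove F⊂G in essential u v Guv (up F⊆G-uv PF)

  -- The arcs of L are deleted one by one where possible; those outside L are known to be essential.
  locallyMinimal-below : ∀ {G} (L : List (Fin n × Fin n)) → P G →
                         (∀ q p → G q p ≡ true → (q , p) ∉ L → ¬ P (remove G q p)) →
                         ¬ ¬ (∃[ H ] H ⊆A G × LocallyMinimal P H)
  locallyMinimal-below {G} [] PG essential =
    pure (G , ⊆-refl , PG , λ q p g → essential q p g λ ())
  locallyMinimal-below {G} ((q , p) ∷ L) PG essential = ¬¬-excluded-middle >>= try-removing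
    where
    essential⁻ : ∀ q′ p′ → remove G q p q′ p′ ≡ true → (q′ , p′) ∉ L →
                 ¬ P (remove (remove G q p) q′ p′)
    essential⁻ q′ p′ g′ ∉L P⁻⁻ =
      essential q′ p′ (remove-⊆ {G = G} q′ p′ g′) ∉qp∷L (up (remove-mono remove-⊆) P⁻⁻)
      where
      ∉qp∷L : (q′ , p′) ∉ (q , p) ∷ L
      ∉qp∷L (here eq)  = remove-≢ {G = G} g′ eq
      ∉qp∷L (there ∈L) = ∉L ∈L

    essential′ : ¬ P (remove G q p) → ∀ q′ p′ → G q′ p′ ≡ true → (q′ , p′) ∉ L →
                 ¬ P (remove G q′ p′)
    essential′ ¬PG⁻ q′ p′ g ∉L with (q′ , p′) ≟ₐ (q , p)
    ... | yes refl = ¬PG⁻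
    ... | no  ≢qp  = essential q′ p′ g λ { (here eq) → ≢qp eq ; (there ∈L) → ∉L ∈L }

    try-removing : Dec (P (remove G q p)) → ¬ ¬ (∃[ H ] H ⊆A G × LocallyMinimal P H)
    try-removing (yes PG⁻) = do
      H , H⊆G⁻ , lmH ← locallyMinimal-below L PG⁻ essential⁻
      pure (H , ⊆-trans H⊆G⁻ remove-⊆ , lmH)
    try-removing (no ¬PG⁻) = locallyMinimal-below L PG (essential′ ¬PG⁻)

  minimal-below : ∀ {G} → P G → ¬ ¬ (∃[ H ] H ⊆A G × Minimal P H)
  minimal-below PG = do
    H , H⊆G , lmH ← locallyMinimal-below (allArcs _) PG λ q p _ ∉all → contradiction (∈-allArcs q p) ∉all
    pure (H , H⊆G , locallyMinimal⇒minimal lmH)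

module _ (D : Digraph n) where

  −A⊆⊛ : ∀ G → (D −A G) ⊆A (D ⊛ G)
  −A⊆⊛ G u v h rewrite h = refl

  −A-antitone : ∀ {F G} → F ⊆A G → (D −A G) ⊆A (D −A F)
  −A-antitone {F} {G} F⊆G u v h with D u v | F u v in Fuv | G u v in Guv
  ... | false | _     | _     = h
  ... | true  | false | _     = refl
  ... | true  | true  | false = contradiction (F⊆G u v Fuv) (not-¬ Guv)
  ... | true  | true  | true  = contradiction h λ ()

  −A-remove : ∀ {G q p u v} → Arc (D −A remove G q p) u v → (u , v) ≡ (q , p) ⊎ Arc (D −A G) u v
  −A-remove {q = q} {p} {u} {v} h with (u , v) ≟ₐ (q , p)
  ... | yes uv≡qp = inj₁ uv≡qp
  ... | no  _     = inj₂ h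

  ⊛-arc : ∀ {G u v} → Arc (D ⊛ G) u v → Arc (D −A G) u v ⊎ Arc G v u
  ⊛-arc {G} {u} {v} h with D u v ∧ not (G u v)
  ... | true  = inj₁ refl
  ... | false = inj₂ h

Loopless : Digraph n → Set
Loopless D = ∀ v → ¬ Arc D v v

module _ (S : VSet n) (T : Digraph n) where

  noSCycle-⊛⇒−A : ∀ {G} → NoSCycle S (T ⊛ G) → NoSCycle S (T −A G)
  noSCycle-⊛⇒−A {G} noCycle c = noCycle (SCycle-mono (−A⊆⊛ T G) c)

  noSCycle-−A-upwardClosed : UpwardClosed (λ G → NoSCycle S (T −A G))
  noSCycle-−A-upwardClosed F⊆G noCycle c = noCycle (SCycle-mono (−A-antitone T F⊆G) c)

  module _ {G : ArcSet n} (minG : Minimal (λ H → NoSCycle S (T −A H)) G) where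

    -- Putting the arc qp back into T − G creates an S-cycle, which must use qp.
    essential-detour : ∀ {q p} → G q p ≡ true → ¬ ¬ Walk (T −A G) p q
    essential-detour {q} {p} g = do
      c ← proj₂ minG (remove G q p) (remove-⊂ g)
      let s , Ss , s⇝s = SCycle⇒SClosedWalk c
      case ⁺-avoids-or-crosses (−A-remove T {G}) s⇝s of λ where
        (inj₁ s⇝s′)         → contradiction (SClosedWalk⇒SCycle (s , Ss , s⇝s′)) (proj₁ minG)
        (inj₂ (s⇝q , p⇝s)) → pure (p⇝s ◅◅ s⇝q)

    ⊛-arc-detour : Loopless G → ∀ {u v} → Arc (T ⊛ G) u v → ¬ ¬ Walk⁺ (T −A G) u v
    ⊛-arc-detour loopless a with ⊛-arc T {G} a
    ... | inj₁ kept     = pure [ kept ]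
    ... | inj₂ reversed = do
      w ← essential-detour reversed
      pure (⋆⇒⁺ (λ { refl → loopless _ reversed }) w)

    ⊛-walk-detour : Loopless G → ∀ {u v} → Walk⁺ (T ⊛ G) u v → ¬ ¬ Walk⁺ (T −A G) u v
    ⊛-walk-detour loopless [ a ]   = ⊛-arc-detour loopless a
    ⊛-walk-detour loopless (a ∷ w) = do
      d  ← ⊛-arc-detour loopless a
      w′ ← ⊛-walk-detour loopless w
      pure (d ++ w′)

    minimal-−A⇒noSCycle-⊛ : Loopless G → NoSCycle S (T ⊛ G)
    minimal-−A⇒noSCycle-⊛ loopless c =
      let s , Ss , s⇝s = SCycle⇒SClosedWalk c
      in ⊛-walk-detour loopless s⇝s λ s⇝s′ → proj₁ minG (SClosedWalk⇒SCycle (s , Ss , s⇝s′))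

mainTheorem4 : (n : ℕ) (T : Digraph n) → IsTournament T → (S : VSet n) (F : ArcSet n) → F ⊆A T →
    Minimal (λ G → NoSCycle S (T −A G)) F ⇔ Minimal (λ G → NoSCycle S (T ⊛ G)) F
mainTheorem4 n T isT S F F⊆T = mk⇔ to from
  where
  loopless : ∀ {G} → G ⊆A T → Loopless G
  loopless G⊆T v Gvv = not-¬ (G⊆T v v Gvv) (IsTournament.irrefl isT v)

  to : Minimal (λ G → NoSCycle S (T −A G)) F → Minimal (λ G → NoSCycle S (T ⊛ G)) F
  to minF = minimal-−A⇒noSCycle-⊛ S T minF (loopless F⊆T)
          , λ F′ F′⊂F noCycle → proj₂ minF F′ F′⊂F (noSCycle-⊛⇒−A S T noCycle)

  from : Minimal (λ G → NoSCycle S (T ⊛ G)) F → Minimal (λ G → NoSCycle S (T −A G)) F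
  from (noCycle , minF) = noSCycle-⊛⇒−A S T noCycle , λ F′ F′⊂F noCycle′ →
    minimal-below (noSCycle-−A-upwardClosed S T) noCycle′ λ (H , H⊆F′ , minH) →
      minF H (⊆-⊂-trans H⊆F′ F′⊂F)
        (minimal-−A⇒noSCycle-⊛ S T minH (loopless (⊆-trans H⊆F′ (⊆-trans (proj₁ F′⊂F) F⊆T))))
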